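{- Let $Q$ be an IPC formula. Every theorem of the axiom system $\mathbb{U}_Q$ is a theorem of IPC.
   Context: The Implicational Propositional Calculus (IPC) has formulas built from propositional variables using only $\supset$, the single inference rule modus ponens, and the axiom schemes $X \supset (Y \supset X)$, $[X \supset (Y \supset Z)] \supset [(X \supset Y) \supset (X \supset Z)]$ and $[(X \supset Y) \supset X] \supset X$. For an IPC formula $Z$ write $QZ := Z \supset Q$. For a sequence $\theta = (Z_N, \dots, Z_0)$ of IPC formulas, $\mathcal{D}(\theta) := Z_N \supset (Z_{N-1} \supset ( \cdots (Z_0 \supset Q) \cdots ))$, and $(W,\theta)$ denotes $(W, Z_N, \dots, Z_0)$, so $\mathcal{D}(W,\theta) = W \supset \mathcal{D}(\theta)$. In what follows $\theta$ ranges over finite sequences of IPC formulas each of the form $QW$ or $QQW$ for some IPC formula $W$; such $\theta$ is closed if for some $W$ both $QW$ and $QQW$ are terms of $\theta$. A formula $\alpha = Q(X\supset Y)$ has $\alpha_0 = QQX$, $\alpha_1 = QY$; a formula $\beta = QQ(X \supset Y)$ has $\beta_0 = QX$, $\beta_1 = QQY$. The system $\mathbb{U}_Q$ has: axioms all formulas $\mathcal{D}(\theta)$ with $\theta$ closed; Rule A: if a formula $\alpha = Q(X\supset Y)$ is a term of $\theta$, then from $\mathcal{D}(\alpha_0,\theta)$ alone, or from $\mathcal{D}(\alpha_1,\theta)$ alone, infer $\mathcal{D}(\theta)$; Rule B: if a formula $\beta = QQ(X\supset Y)$ is a term of $\theta$, then from $\mathcal{D}(\beta_0,\theta)$ and $\mathcal{D}(\beta_1,\theta)$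 together infer $\mathcal{D}(\theta)$. The theorems of $\mathbb{U}_Q$ form the smallest set of formulas containing its axioms and closed under Rules A and B. -}

module Defs where

open import Data.Nat using (ℕ)
open import Data.List using (List; []; _∷_)
open import Data.List.Membership.Propositional using (_∈_)
open import Data.List.Relation.Unary.All using (All)
open import Data.Product using (Σ; ∃; _×_; _,_)
open import Data.Sum using (_⊎_)
open import Relation.Binary.PropositionalEquality using (_≡_)

infixr 5 _⊃_
data Formula : Set where
  var : ℕ → Formula
  _⊃_ : Formula → Formula → Formula

data IPC : Formula → Set where
  ax1 : ∀ X Y → IPC (X ⊃ (Y ⊃ X))
  ax2 : ∀ X Y Z → IPC ((X ⊃ (Y ⊃ Z)) ⊃ ((X ⊃ Y) ⊃ (X ⊃ Z)))
  ax3 : ∀ X Y → IPC (((X ⊃ Y) ⊃ X) ⊃ X)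
  mp  : ∀ {X Y} → IPC (X ⊃ Y) → IPC X → IPC Y

module _ (Q : Formula) where

  QF : Formula → Formula
  QF Z = Z ⊃ Q

  -- θ = (Z_N, …, Z_0) is a list, head = Z_N;
  -- D(θ) = Z_N ⊃ (… (Z_0 ⊃ Q) …)
  D : List Formula → Formula
  D []      = Q
  D (Z ∷ θ) = Z ⊃ D θ

  Signed : Formula → Set
  Signed Z = ∃ λ W → (Z ≡ QF W) ⊎ (Z ≡ QF (QF W))

  Admissible : List Formula → Set
  Admissible θ = All Signed θ

  Closed : List Formula → Set
  Closed θ = ∃ λ W → (QF W ∈ θ) × (QF (QF W) ∈ θ)

  -- Derivations in U_Q: U θ means D(θ) is derived (with θ admissible)
  data U : List Formula → Set where
    axiom : ∀ {θ} → Admissible θ → Closed θ → U θ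
    ruleA₀ : ∀ {θ} X Y → Admissible θ → QF (X ⊃ Y) ∈ θ →
             U (QF (QF X) ∷ θ) → U θ
    ruleA₁ : ∀ {θ} X Y → Admissible θ → QF (X ⊃ Y) ∈ θ →
             U (QF Y ∷ θ) → U θ
    ruleB  : ∀ {θ} X Y → Admissible θ → QF (QF (X ⊃ Y)) ∈ θ →
             U (QF X ∷ θ) → U (QF (QF Y) ∷ θ) → U θ

  UThm : Formula → Set
  UThm F = Σ (List Formula) λ θ → U θ × (D θ ≡ F)

-- A derivation in U_Q of θ = (Z_N, …, Z_0) is read as the claim that the
-- hypotheses Z_N, …, Z_0 entail Q.
-- Theorem 10 follows by discharging all hypotheses of a sound derivation.
module Submission where

open import Defs
open import Data.List using (List; []; _∷_)
open import Data.List.Membership.Propositional using (_∈_)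
open import Data.List.Relation.Binary.Subset.Propositional using (_⊆_)
open import Data.List.Relation.Binary.Subset.Propositional.Properties
  using (xs⊆x∷xs; ∷⁺ʳ; ∈-∷⁺ʳ)
open import Data.List.Relation.Unary.Any using (here; there)
open import Data.Product using (_,_)
open import Relation.Binary.PropositionalEquality using (refl)

infix  3 _⊢_
infixl 6 _·_

data _⊢_ (Γ : List Formula) : Formula → Set where
  hyp    : ∀ {A} → A ∈ Γ → Γ ⊢ A
  K      : ∀ X Y → Γ ⊢ X ⊃ (Y ⊃ X)
  S      : ∀ X Y Z → Γ ⊢ (X ⊃ (Y ⊃ Z)) ⊃ ((X ⊃ Y) ⊃ (X ⊃ Z))
  peirce : ∀ X Y → Γ ⊢ ((X ⊃ Y) ⊃ X) ⊃ X
  _·_    : ∀ {X Y} → Γ ⊢ X ⊃ Y → Γ ⊢ X → Γ ⊢ Y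

closed⇒IPC : ∀ {A} → [] ⊢ A → IPC A
closed⇒IPC (hyp ())
closed⇒IPC (K X Y)      = ax1 X Y
closed⇒IPC (S X Y Z)    = ax2 X Y Z
closed⇒IPC (peirce X Y) = ax3 X Y
closed⇒IPC (f · x)      = mp (closed⇒IPC f) (closed⇒IPC x)

weaken : ∀ {Γ Δ A} → Γ ⊆ Δ → Γ ⊢ A → Δ ⊢ A
weaken s (hyp p)      = hyp (s p)
weaken s (K X Y)      = K X Y
weaken s (S X Y Z)    = S X Y Z
weaken s (peirce X Y) = peirce X Y
weaken s (f · x)      = weaken s f · weaken s x

wk : ∀ {Γ A B} → Γ ⊢ A → B ∷ Γ ⊢ A
wk {Γ} {B = B} = weaken (xs⊆x∷xs Γ B)

#0 : ∀ {Γ A} → A ∷ Γ ⊢ A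
#0 = hyp (here refl)

#1 : ∀ {Γ A B} → B ∷ A ∷ Γ ⊢ A
#1 = hyp (there (here refl))

#2 : ∀ {Γ A B C} → C ∷ B ∷ A ∷ Γ ⊢ A
#2 = hyp (there (there (here refl)))

⊃-intro : ∀ {Γ A B} → A ∷ Γ ⊢ B → Γ ⊢ A ⊃ B
⊃-intro {A = A} (hyp (here refl)) = S A (A ⊃ A) A · K A (A ⊃ A) · K A A
⊃-intro {A = A} (hyp (there p))   = K _ A · hyp p
⊃-intro {A = A} (K X Y)           = K _ A · K X Y
⊃-intro {A = A} (S X Y Z)         = K _ A · S X Y Z
⊃-intro {A = A} (peirce X Y)      = K _ A · peirce X Y
⊃-intro {A = A} (f · x)           = S A _ _ · ⊃-intro f · ⊃-intro x

by-peirce : ∀ {Γ A} B → (A ⊃ B) ∷ Γ ⊢ A → Γ ⊢ A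
by-peirce {A = A} B d = peirce A B · ⊃-intro d

-- The rules of U_Q as derived rules of IPC, for an arbitrary formula Q.
-- A premise D(Z, θ) of a rule appears as a derivation of Z ⊃ Q from
-- Γ ⊇ θ; the rule's side formula is a hypothesis of Γ.
module _ (Q : Formula) where

  -- Rule A with premise QQX: assuming Q ⊃ Y, the map x ↦ Y through
  -- QQX ⊃ Q (applied to λk. k x) proves X ⊃ Y, refuting Q(X ⊃ Y).
  ruleA₀-sound : ∀ {Γ X Y} → Γ ⊢ (X ⊃ Y) ⊃ Q →
                 Γ ⊢ ((X ⊃ Q) ⊃ Q) ⊃ Q → Γ ⊢ Q
  ruleA₀-sound {Y = Y} α prem =
    by-peirce Y (wk α · ⊃-intro (#1 · (wk (wk prem) · ⊃-intro (#0 · #1))))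

  -- Rule A with premise QY: assuming Q ⊃ Y, Peirce's law at Y together
  -- with QY ⊃ Q proves Y, hence X ⊃ Y, refuting Q(X ⊃ Y).
  ruleA₁-sound : ∀ {Γ X Y} → Γ ⊢ (X ⊃ Y) ⊃ Q →
                 Γ ⊢ (Y ⊃ Q) ⊃ Q → Γ ⊢ Q
  ruleA₁-sound {Γ} {X} {Y} α prem = by-peirce Y (wk α · (K Y X · y))
    where
    y : (Q ⊃ Y) ∷ Γ ⊢ Y
    y = by-peirce Q (#1 · (wk (wk prem) · #0))

  -- Rule B: QQ(X ⊃ Y) applied to λh. prem₀ (λx. prem₁ (λk. k (h x))).
  ruleB-sound : ∀ {Γ X Y} → Γ ⊢ ((X ⊃ Y) ⊃ Q) ⊃ Q →
                Γ ⊢ (X ⊃ Q) ⊃ Q → Γ ⊢ ((Y ⊃ Q) ⊃ Q) ⊃ Q → Γ ⊢ Q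
  ruleB-sound β prem₀ prem₁ =
    β · ⊃-intro (wk prem₀ · ⊃-intro (wk (wk prem₁) · ⊃-intro (#0 · (#2 · #1))))

  sound   : ∀ {θ Γ} → U Q θ → θ ⊆ Γ → Γ ⊢ Q
  premise : ∀ {Z θ Γ} → U Q (Z ∷ θ) → θ ⊆ Γ → Γ ⊢ Z ⊃ Q

  premise d s = ⊃-intro (sound d (∷⁺ʳ _ s))

  sound (axiom _ (_ , qW , qqW)) s = hyp (s qqW) · hyp (s qW)
  sound (ruleA₀ _ _ _ α d) s = ruleA₀-sound (hyp (s α)) (premise d s)
  sound (ruleA₁ _ _ _ α d) s = ruleA₁-sound (hyp (s α)) (premise d s)
  sound (ruleB _ _ _ β d e) s =
    ruleB-sound (hyp (s β)) (premise d s) (premise e s)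

  discharge : ∀ θ {Γ} → (∀ {Δ} → θ ⊆ Δ → Γ ⊆ Δ → Δ ⊢ Q) → Γ ⊢ D Q θ
  discharge []      entails = entails (λ ()) (λ p → p)
  discharge (Z ∷ θ) entails =
    ⊃-intro (discharge θ (λ θ⊆Δ Z∷Γ⊆Δ →
      entails (∈-∷⁺ʳ (Z∷Γ⊆Δ (here refl)) θ⊆Δ) (λ p → Z∷Γ⊆Δ (there p))))

theorem10 : (Q F : Formula) → UThm Q F → IPC F
theorem10 Q .(D Q θ) (θ , u , refl) =
  closed⇒IPC (discharge Q θ (λ θ⊆Δ _ → sound Q u θ⊆Δ))
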